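{- For every integer $n\ge 0$, \begin{equation*} \widetilde{J}_2(n)=\sum_{k=0}^n (-1)^k \binom{ -\frac12}{k}^{\!\!2}\binom{n}{k}. \end{equation*}
   Context: For $n\ge0$ let \begin{equation*} J_2(n) := \int_0^\infty\!\!\int_0^\infty \frac{e^{ -(t+s)/2}}{1-e^{ -(t+s)}} \left(\frac{(1-e^{ -2t})(1-e^{ -2s})}{(1-e^{ -(t+s)})^2}\right)^{\!n} dt\,ds , \end{equation*} and set $\widetilde{J}_2(n):=J_2(n)/J_2(0)$ (note $J_2(0)=3\zeta(2)$). Equivalently, $\widetilde{J}_2(n)$ is the sequence of rationals determined by $\widetilde{J}_2(0)=1$, $\widetilde{J}_2(1)=\frac34$ and the recurrence $4n^2 \widetilde{J}_2(n)-(8n^2-8n+3)\widetilde{J}_2(n-1)+4(n-1)^2\widetilde{J}_2(n-2)=0$ for $n\ge2$. The result is deduced from the fact that the generating function $w_2(z)=\sum_{n\ge0}J_2(n)z^n$ equals $\frac{J_2(0)}{1-z}\,{}_2F_1\!\left(\frac12,\frac12;1;\frac{z}{z-1}\right)$, where ${}_2F_1$ is the Gauss hypergeometric function. -}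

module Defs where

open import Data.Nat using (ℕ; zero; suc)
open import Data.Integer using (+_)
open import Data.Rational using (ℚ; 0ℚ; 1ℚ; _+_; _-_; _*_; -_; _/_)
open import Data.Nat.Combinatorics using (_C_)

ι : ℕ → ℚ
ι n = + n / 1

-- J̃₂ defined by J̃₂(0) = 1, J̃₂(1) = 3/4 and, for m ≥ 2,
-- 4 m² J̃₂(m) = (8 m² − 8 m + 3) J̃₂(m−1) − 4 (m−1)² J̃₂(m−2).
-- Here m = n + 2, written with m² = (n+2)², 8m²−8m+3 = 8(n+2)(n+1)+3.
J̃₂ : ℕ → ℚ
J̃₂ zero = 1ℚ
J̃₂ (suc zero) = + 3 / 4
J̃₂ (suc (suc n)) =
  ((ι (8 Data.Nat.* (n Data.Nat.+ 2) Data.Nat.* (n Data.Nat.+ 1) Data.Nat.+ 3) * J̃₂ (suc n)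
     - ι (4 Data.Nat.* (n Data.Nat.+ 1) Data.Nat.* (n Data.Nat.+ 1)) * J̃₂ n)
   * (+ 1 / (4 Data.Nat.* (2 Data.Nat.+ n) Data.Nat.* (2 Data.Nat.+ n))))

gbinom : ℚ → ℕ → ℚ
gbinom x zero = 1ℚ
gbinom x (suc k) = (gbinom x k * (x - ι k)) * (+ 1 / suc k)

sign : ℕ → ℚ
sign zero = 1ℚ
sign (suc k) = - sign k

sumTo : ℕ → (ℕ → ℚ) → ℚ
sumTo zero f = f 0
sumTo (suc n) f = sumTo n f + f (suc n)

rhs : ℕ → ℚ
rhs n = sumTo n (λ k → sign k * (gbinom (- (+ 1 / 2)) k * gbinom (- (+ 1 / 2)) k) * ι (n C k))

{-# OPTIONS --safe #-}
-- Write c k = (-1)^k binom(-1/2,k)^2, F n k = c k binom(n,k) and G n k = (2k+1)^2 c k binom(n+1,k).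
-- Creative telescoping in k gives
--   4(n+2)^2 F (n+2) k - (8(n+2)(n+1)+3) F (n+1) k + 4(n+1)^2 F n k = G n k - G n (k-1),
-- which is a polynomial identity once Pascal's rule, absorption (k+1) binom(n+1,k+1) = (n+1) binom(n,k)
-- and 4(k+1)^2 c (k+1) = -(2k+1)^2 c k are used.  Summing over k <= n+2 telescopes to G n (n+2) = 0,
-- so the right-hand side satisfies the recurrence defining J̃₂, and the initial values agree.
module Submission where

open import Defs
open import Data.Nat using (ℕ)
open import Data.Rational using (ℚ)
open import Relation.Binary.PropositionalEquality using (_≡_)

open import Data.List using ([]; _∷_)
open import Level using (0ℓ)
open import Data.Nat as ℕ using (zero; suc; _<_; s≤s)
import Data.Nat.Properties as ℕ
import Data.Nat.Coprimality as Coprime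
open import Data.Nat.Combinatorics using (_C_; nCk+nC[k+1]≡[n+1]C[k+1]; k>n⇒nCk≡0; nC1≡n)
open import Data.Integer as ℤ using (+_)
import Data.Integer.Properties as ℤ
open import Data.Rational using (0ℚ; 1ℚ; _+_; _-_; _*_; -_; _/_; mkℚ)
import Data.Rational.Properties as ℚ
open import Relation.Nullary.Decidable using (dec⇒maybe)
open import Relation.Binary.PropositionalEquality using (refl; sym; trans; cong; cong₂; module ≡-Reasoning)
open import Tactic.RingSolver using (solve-∀; solve)
import Tactic.RingSolver.Core.AlmostCommutativeRing as ACR

open ≡-Reasoning

-- The reflective solver treats defined functions such as P₂ or oddSquare as opaque constants,
-- so every equation handed to it below is written with those definitions unfolded.
ℚ-ring : ACR.AlmostCommutativeRing 0ℓ 0ℓ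
ℚ-ring = ACR.fromCommutativeRing ℚ.+-*-commutativeRing (λ x → dec⇒maybe (0ℚ ℚ.≟ x))

ι≡mkℚ : ∀ m → ι m ≡ mkℚ (+ m) 0 (Coprime.sym (Coprime.1-coprimeTo m))
ι≡mkℚ m = ℚ.normalize-coprime _

ι-+ : ∀ m n → ι (m ℕ.+ n) ≡ ι m + ι n
ι-+ m n rewrite ι≡mkℚ m | ι≡mkℚ n =
  ℚ./-cong (trans (ℤ.pos-+ m n) (sym (cong₂ ℤ._+_ (ℤ.*-identityʳ (+ m)) (ℤ.*-identityʳ (+ n))))) refl

ι-* : ∀ m n → ι (m ℕ.* n) ≡ ι m * ι n
ι-* m n rewrite ι≡mkℚ m | ι≡mkℚ n = ℚ./-cong (ℤ.pos-* m n) refl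

ι-*-inverseʳ : ∀ m .{{_ : ℕ.NonZero m}} → ι m * (+ 1 / m) ≡ 1ℚ
ι-*-inverseʳ (suc k) rewrite ι≡mkℚ (suc k) | ℚ.normalize-coprime {1} {k} (Coprime.1-coprimeTo (suc k)) =
  ℚ.*-inverseʳ (mkℚ (+ suc k) 0 (Coprime.sym (Coprime.1-coprimeTo (suc k))))

sumTo-linear : ∀ n (a b c : ℚ) (f g h : ℕ → ℚ) →
  sumTo n (λ k → a * f k - b * g k + c * h k) ≡ a * sumTo n f - b * sumTo n g + c * sumTo n h
sumTo-linear zero a b c f g h = refl
sumTo-linear (suc n) a b c f g h =
  trans (cong (_+ (a * f (suc n) - b * g (suc n) + c * h (suc n))) (sumTo-linear n a b c f g h))
        (regroup a b c (sumTo n f) (sumTo n g) (sumTo n h) (f (suc n)) (g (suc n)) (h (suc n)))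
  where
  regroup : ∀ a b c x y z x′ y′ z′ →
    (a * x - b * y + c * z) + (a * x′ - b * y′ + c * z′) ≡ a * (x + x′) - b * (y + y′) + c * (z + z′)
  regroup = solve-∀ ℚ-ring

sumTo-telescoping : ∀ {L G : ℕ → ℚ} → L 0 ≡ G 0 → (∀ k → L (suc k) ≡ G (suc k) - G k) →
                    ∀ n → sumTo n L ≡ G n
sumTo-telescoping L₀ Lₛ zero = L₀
sumTo-telescoping {L} {G} L₀ Lₛ (suc n) =
  trans (cong₂ _+_ (sumTo-telescoping {L} {G} L₀ Lₛ n) (Lₛ n)) (cancel (G n) (G (suc n)))
  where
  cancel : ∀ x y → x + (y - x) ≡ y
  cancel = solve-∀ ℚ-ring

sumTo-beyond-support : ∀ {m} {f : ℕ → ℚ} → (∀ {k} → m < k → f k ≡ 0ℚ) →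
                       ∀ i → sumTo (i ℕ.+ m) f ≡ sumTo m f
sumTo-beyond-support f≡0 zero = refl
sumTo-beyond-support {m} {f} f≡0 (suc i) = begin
    sumTo (i ℕ.+ m) f + f (suc (i ℕ.+ m))
  ≡⟨ cong₂ _+_ (sumTo-beyond-support f≡0 i) (f≡0 (s≤s (ℕ.m≤n+m m i))) ⟩
    sumTo m f + 0ℚ
  ≡⟨ ℚ.+-identityʳ (sumTo m f) ⟩
    sumTo m f
  ∎

[k+1]*[n+1]C[k+1]≡[n+1]*nCk : ∀ n k → suc k ℕ.* (suc n C suc k) ≡ suc n ℕ.* (n C k)
[k+1]*[n+1]C[k+1]≡[n+1]*nCk zero zero = refl
[k+1]*[n+1]C[k+1]≡[n+1]*nCk zero (suc k) = ℕ.*-zeroʳ (suc (suc k))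
[k+1]*[n+1]C[k+1]≡[n+1]*nCk (suc n) zero =
  trans (ℕ.*-identityˡ _) (trans (nC1≡n (suc (suc n))) (sym (ℕ.*-identityʳ _)))
[k+1]*[n+1]C[k+1]≡[n+1]*nCk (suc n) (suc k) = begin
    suc (suc k) ℕ.* (suc (suc n) C suc (suc k))
  ≡⟨ cong (suc (suc k) ℕ.*_) (sym (nCk+nC[k+1]≡[n+1]C[k+1] (suc n) (suc k))) ⟩
    suc (suc k) ℕ.* (X ℕ.+ suc n C suc (suc k))
  ≡⟨ ℕ.*-distribˡ-+ (suc (suc k)) X _ ⟩
    (X ℕ.+ suc k ℕ.* X) ℕ.+ suc (suc k) ℕ.* (suc n C suc (suc k))
  ≡⟨ ℕ.+-assoc X _ _ ⟩
    X ℕ.+ (suc k ℕ.* X ℕ.+ suc (suc k) ℕ.* (suc n C suc (suc k)))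
  ≡⟨ cong (X ℕ.+_) (cong₂ ℕ._+_ ([k+1]*[n+1]C[k+1]≡[n+1]*nCk n k)
                                ([k+1]*[n+1]C[k+1]≡[n+1]*nCk n (suc k))) ⟩
    X ℕ.+ (suc n ℕ.* (n C k) ℕ.+ suc n ℕ.* (n C suc k))
  ≡⟨ cong (X ℕ.+_) (sym (ℕ.*-distribˡ-+ (suc n) (n C k) (n C suc k))) ⟩
    X ℕ.+ suc n ℕ.* (n C k ℕ.+ n C suc k)
  ≡⟨ cong (λ t → X ℕ.+ suc n ℕ.* t) (nCk+nC[k+1]≡[n+1]C[k+1] n k) ⟩
    suc (suc n) ℕ.* X
  ∎
  where
  X : ℕ
  X = suc n C suc k

ι-pascal : ∀ n k → ι (suc n C suc k) ≡ ι (n C k) + ι (n C suc k)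
ι-pascal n k = trans (cong ι (sym (nCk+nC[k+1]≡[n+1]C[k+1] n k))) (ι-+ (n C k) (n C suc k))

ι-absorption : ∀ n k → ι (suc k) * ι (suc n C suc k) ≡ ι (suc n) * ι (n C k)
ι-absorption n k = begin
    ι (suc k) * ι (suc n C suc k)    ≡⟨ ι-* (suc k) (suc n C suc k) ⟨
    ι (suc k ℕ.* (suc n C suc k))    ≡⟨ cong ι ([k+1]*[n+1]C[k+1]≡[n+1]*nCk n k) ⟩
    ι (suc n ℕ.* (n C k))            ≡⟨ ι-* (suc n) (n C k) ⟩
    ι (suc n) * ι (n C k)            ∎

k>n⇒x*ι[nCk]≡0 : ∀ x {n k} → n < k → x * ι (n C k) ≡ 0ℚ
k>n⇒x*ι[nCk]≡0 x n<k = trans (cong (λ t → x * ι t) (k>n⇒nCk≡0 n<k)) (ℚ.*-zeroʳ x)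

oddSquare : ℚ → ℚ
oddSquare x = (ι 2 * x + 1ℚ) * (ι 2 * x + 1ℚ)

coeff : ℕ → ℚ
coeff k = sign k * (gbinom (- (+ 1 / 2)) k * gbinom (- (+ 1 / 2)) k)

coeff-ratio : ∀ k → ι 4 * ι (suc k) * ι (suc k) * coeff (suc k) ≡ - (oddSquare (ι k) * coeff k)
coeff-ratio k = begin
    ι 4 * ι (suc k) * ι (suc k) * coeff (suc k)
  ≡⟨ cong (λ t → ι 4 * t * t * coeff (suc k)) (ι-+ 1 k) ⟩
    ι 4 * (ι 1 + ι k) * (ι 1 + ι k) * coeff (suc k)
  ≡⟨ unfolded-ratio (sign k) (gbinom (- (+ 1 / 2)) k) (ι k) (+ 1 / suc k)
       (trans (cong (_* (+ 1 / suc k)) (sym (ι-+ 1 k))) (ι-*-inverseʳ (suc k))) ⟩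
    - (oddSquare (ι k) * coeff k)
  ∎
  where
  unfolded-ratio : ∀ σ γ x r → (ι 1 + x) * r ≡ 1ℚ →
    ι 4 * (ι 1 + x) * (ι 1 + x) * (- σ * ((γ * (- (+ 1 / 2) - x)) * r * ((γ * (- (+ 1 / 2) - x)) * r)))
      ≡ - (oddSquare x * (σ * (γ * γ)))
  unfolded-ratio σ γ x r [1+x]r≡1 = begin
      ι 4 * (ι 1 + x) * (ι 1 + x) * (- σ * ((γ * (- (+ 1 / 2) - x)) * r * ((γ * (- (+ 1 / 2) - x)) * r)))
    ≡⟨ solve (σ ∷ γ ∷ x ∷ r ∷ []) ℚ-ring ⟩
      - ((ι 2 * x + 1ℚ) * (ι 2 * x + 1ℚ) * (σ * (γ * γ))) * ((ι 1 + x) * r * ((ι 1 + x) * r))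
    ≡⟨ cong (λ t → - (oddSquare x * (σ * (γ * γ))) * (t * t)) [1+x]r≡1 ⟩
      - (oddSquare x * (σ * (γ * γ))) * 1ℚ
    ≡⟨ ℚ.*-identityʳ _ ⟩
      - (oddSquare x * (σ * (γ * γ)))
    ∎

P₂ P₁ P₀ : ℚ → ℚ
P₂ x = ι 4 * (ι 2 + x) * (ι 2 + x)
P₁ x = ι 8 * (x + ι 2) * (x + ι 1) + ι 3
P₀ x = ι 4 * (x + ι 1) * (x + ι 1)

-- The factors 1ℚ are the values of term m 0, so that this is literally
-- recurrence-summand n 0 ≡ antidifference n 0.
P₂-P₁+P₀≡1 : ∀ x → P₂ x * 1ℚ - P₁ x * 1ℚ + P₀ x * 1ℚ ≡ 1ℚ
P₂-P₁+P₀≡1 x = begin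
    ι 4 * (ι 2 + x) * (ι 2 + x) * 1ℚ - (ι 8 * (x + ι 2) * (x + ι 1) + ι 3) * 1ℚ
      + ι 4 * (x + ι 1) * (x + ι 1) * 1ℚ
  ≡⟨ solve (x ∷ []) ℚ-ring ⟩
    1ℚ
  ∎

≡-by-certificate : ∀ {l r p₁ q₁ p₂ q₂ p₃ q₃ : ℚ} a₁ a₂ a₃ → p₁ ≡ q₁ → p₂ ≡ q₂ → p₃ ≡ q₃ →
                   l ≡ r + (a₁ * (p₁ - q₁) + a₂ * (p₂ - q₂) + a₃ * (p₃ - q₃)) → l ≡ r
≡-by-certificate {r = r} {p₁} {p₂ = p₂} {p₃ = p₃} a₁ a₂ a₃ refl refl refl l≡r+⋯ =
  trans l≡r+⋯ (cancel r a₁ a₂ a₃ p₁ p₂ p₃)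
  where
  cancel : ∀ r a₁ a₂ a₃ p₁ p₂ p₃ → r + (a₁ * (p₁ - p₁) + a₂ * (p₂ - p₂) + a₃ * (p₃ - p₃)) ≡ r
  cancel = solve-∀ ℚ-ring

creative-telescoping-identity : ∀ N J c d u s z {K M₁ M₂ x y : ℚ} →
  K ≡ ι 1 + J → M₁ ≡ ι 1 + N → M₂ ≡ ι 2 + N → x ≡ u + y → y ≡ s + z →
  K * x ≡ M₂ * u → K * y ≡ M₁ * s → ι 4 * K * K * c ≡ - (oddSquare J * d) →
  P₂ N * (c * x) - P₁ N * (c * y) + P₀ N * (c * z) ≡ oddSquare K * c * y - oddSquare J * d * u
creative-telescoping-identity N J c d u s z refl refl refl refl refl abs₂ abs₁ ratio =
  ≡-by-certificate (c * (ι 4 * (N + ι 1))) (- (c * (ι 4 * (N + ι 3 + J)))) u abs₁ abs₂ ratio certificate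
  where
  certificate :
    ι 4 * (ι 2 + N) * (ι 2 + N) * (c * (u + (s + z))) - (ι 8 * (N + ι 2) * (N + ι 1) + ι 3) * (c * (s + z))
      + ι 4 * (N + ι 1) * (N + ι 1) * (c * z)
    ≡ (ι 2 * (ι 1 + J) + 1ℚ) * (ι 2 * (ι 1 + J) + 1ℚ) * c * (s + z) - (ι 2 * J + 1ℚ) * (ι 2 * J + 1ℚ) * d * u
      + (c * (ι 4 * (N + ι 1)) * ((ι 1 + J) * (s + z) - (ι 1 + N) * s)
         + - (c * (ι 4 * (N + ι 3 + J))) * ((ι 1 + J) * (u + (s + z)) - (ι 2 + N) * u)
         + u * (ι 4 * (ι 1 + J) * (ι 1 + J) * c - - ((ι 2 * J + 1ℚ) * (ι 2 * J + 1ℚ) * d)))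
  certificate = solve (N ∷ J ∷ c ∷ d ∷ z ∷ u ∷ s ∷ []) ℚ-ring

term : ℕ → ℕ → ℚ
term n k = coeff k * ι (n C k)

recurrence-summand : ℕ → ℕ → ℚ
recurrence-summand n k = P₂ (ι n) * term (2 ℕ.+ n) k - P₁ (ι n) * term (1 ℕ.+ n) k + P₀ (ι n) * term n k

term-vanishes : ∀ n {k} → n < k → term n k ≡ 0ℚ
term-vanishes n {k} = k>n⇒x*ι[nCk]≡0 (coeff k)

antidifference : ℕ → ℕ → ℚ
antidifference n k = oddSquare (ι k) * coeff k * ι (suc n C k)

recurrence-summand-zero : ∀ n → recurrence-summand n 0 ≡ antidifference n 0
recurrence-summand-zero n = P₂-P₁+P₀≡1 (ι n)

recurrence-summand-suc : ∀ n k → recurrence-summand n (suc k) ≡ antidifference n (suc k) - antidifference n k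
recurrence-summand-suc n k =
  creative-telescoping-identity (ι n) (ι k) (coeff (suc k)) (coeff k) (ι (suc n C k)) (ι (n C k)) (ι (n C suc k))
    (ι-+ 1 k) (ι-+ 1 n) (ι-+ 2 n) (ι-pascal (suc n) k) (ι-pascal n k)
    (ι-absorption (suc n) k) (ι-absorption n k) (coeff-ratio k)

-- Spelled exactly as in the definition of J̃₂, so that J̃₂ (2 + n) is definitionally
-- recurrence-step n (J̃₂ (1 + n)) (J̃₂ n).
p₂ p₁ p₀ : ℕ → ℕ
p₂ n = 4 ℕ.* (2 ℕ.+ n) ℕ.* (2 ℕ.+ n)
p₁ n = 8 ℕ.* (n ℕ.+ 2) ℕ.* (n ℕ.+ 1) ℕ.+ 3
p₀ n = 4 ℕ.* (n ℕ.+ 1) ℕ.* (n ℕ.+ 1)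

recurrence-step : ℕ → ℚ → ℚ → ℚ
recurrence-step n x y = (ι (p₁ n) * x - ι (p₀ n) * y) * (+ 1 / p₂ n)

ι-p₂ : ∀ n → ι (p₂ n) ≡ P₂ (ι n)
ι-p₂ n = trans (ι-* (4 ℕ.* (2 ℕ.+ n)) (2 ℕ.+ n))
               (cong₂ _*_ (trans (ι-* 4 (2 ℕ.+ n)) (cong (ι 4 *_) (ι-+ 2 n))) (ι-+ 2 n))

ι-p₁ : ∀ n → ι (p₁ n) ≡ P₁ (ι n)
ι-p₁ n = trans (ι-+ (8 ℕ.* (n ℕ.+ 2) ℕ.* (n ℕ.+ 1)) 3)
               (cong (_+ ι 3) (trans (ι-* (8 ℕ.* (n ℕ.+ 2)) (n ℕ.+ 1))
                                     (cong₂ _*_ (trans (ι-* 8 (n ℕ.+ 2)) (cong (ι 8 *_) (ι-+ n 2))) (ι-+ n 1))))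

ι-p₀ : ∀ n → ι (p₀ n) ≡ P₀ (ι n)
ι-p₀ n = trans (ι-* (4 ℕ.* (n ℕ.+ 1)) (n ℕ.+ 1))
               (cong₂ _*_ (trans (ι-* 4 (n ℕ.+ 1)) (cong (ι 4 *_) (ι-+ n 1))) (ι-+ n 1))

rhs-residual : ∀ n → ι (p₂ n) * rhs (2 ℕ.+ n) - ι (p₁ n) * rhs (1 ℕ.+ n) + ι (p₀ n) * rhs n ≡ 0ℚ
rhs-residual n = begin
    ι (p₂ n) * rhs (2 ℕ.+ n) - ι (p₁ n) * rhs (1 ℕ.+ n) + ι (p₀ n) * rhs n
  ≡⟨ cong₂ (λ d a → d * rhs (2 ℕ.+ n) - a * rhs (1 ℕ.+ n) + ι (p₀ n) * rhs n) (ι-p₂ n) (ι-p₁ n) ⟩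
    P₂ N * rhs (2 ℕ.+ n) - P₁ N * rhs (1 ℕ.+ n) + ι (p₀ n) * rhs n
  ≡⟨ cong (λ b → P₂ N * rhs (2 ℕ.+ n) - P₁ N * rhs (1 ℕ.+ n) + b * rhs n) (ι-p₀ n) ⟩
    P₂ N * rhs (2 ℕ.+ n) - P₁ N * rhs (1 ℕ.+ n) + P₀ N * rhs n
  ≡⟨ cong₂ (λ x y → P₂ N * rhs (2 ℕ.+ n) - P₁ N * x + P₀ N * y)
       (sumTo-beyond-support (term-vanishes (1 ℕ.+ n)) 1) (sumTo-beyond-support (term-vanishes n) 2) ⟨
    P₂ N * sumTo (2 ℕ.+ n) (term (2 ℕ.+ n)) - P₁ N * sumTo (2 ℕ.+ n) (term (1 ℕ.+ n))
      + P₀ N * sumTo (2 ℕ.+ n) (term n)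
  ≡⟨ sumTo-linear (2 ℕ.+ n) (P₂ N) (P₁ N) (P₀ N) (term (2 ℕ.+ n)) (term (1 ℕ.+ n)) (term n) ⟨
    sumTo (2 ℕ.+ n) (recurrence-summand n)
  ≡⟨ sumTo-telescoping {recurrence-summand n} {antidifference n}
       (recurrence-summand-zero n) (recurrence-summand-suc n) (2 ℕ.+ n) ⟩
    antidifference n (2 ℕ.+ n)
  ≡⟨ k>n⇒x*ι[nCk]≡0 (oddSquare (ι (2 ℕ.+ n)) * coeff (2 ℕ.+ n)) (ℕ.n<1+n (suc n)) ⟩
    0ℚ
  ∎
  where
  N = ι n

isolate-leading : ∀ d a b r x y z → d * r ≡ 1ℚ → d * x - a * y + b * z ≡ 0ℚ → (a * y - b * z) * r ≡ x
isolate-leading d a b r x y z dr≡1 residual≡0 = begin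
    (a * y - b * z) * r
  ≡⟨ solve (d ∷ a ∷ b ∷ r ∷ x ∷ y ∷ z ∷ []) ℚ-ring ⟩
    x * (d * r) - (d * x - a * y + b * z) * r
  ≡⟨ cong₂ (λ t e → x * t - e * r) dr≡1 residual≡0 ⟩
    x * 1ℚ - 0ℚ * r
  ≡⟨ solve (r ∷ x ∷ []) ℚ-ring ⟩
    x
  ∎

rhs-recurrence : ∀ n → recurrence-step n (rhs (1 ℕ.+ n)) (rhs n) ≡ rhs (2 ℕ.+ n)
rhs-recurrence n =
  isolate-leading (ι (p₂ n)) (ι (p₁ n)) (ι (p₀ n)) (+ 1 / p₂ n) (rhs (2 ℕ.+ n)) (rhs (1 ℕ.+ n)) (rhs n)
    (ι-*-inverseʳ (p₂ n)) (rhs-residual n)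

corollary3p2 : (n : ℕ) → J̃₂ n ≡ rhs n
corollary3p2 zero = refl
corollary3p2 (suc zero) = refl
corollary3p2 (suc (suc n)) = begin
    J̃₂ (2 ℕ.+ n)
  ≡⟨⟩
    recurrence-step n (J̃₂ (1 ℕ.+ n)) (J̃₂ n)
  ≡⟨ cong₂ (recurrence-step n) (corollary3p2 (suc n)) (corollary3p2 n) ⟩
    recurrence-step n (rhs (1 ℕ.+ n)) (rhs n)
  ≡⟨ rhs-recurrence n ⟩
    rhs (2 ℕ.+ n)
  ∎
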